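{- Let $n\ge2$ and let $\mathsf r=[r_1,\dots,r_{2n-2}]$ be a tree-like factorization of $\lambda_n$. For each $k\in\{1,\dots,n-1\}$, there are exactly two indices $\ell$ such that $r_\ell$ increases $k$, and these are the first and the last indices $\ell$ for which $r_\ell$ can be written as $(\!(a,b)\!)$ with $a\equiv k$ or $b\equiv k\pmod n$.
   Context: $\widetilde S_n$ is the affine symmetric group: bijections $w:\mathbb Z\to\mathbb Z$ with $w(i+n)=w(i)+n$ and $\sum_{i=1}^n w(i)=\binom{n+1}{2}$, multiplied by composition $(vw)(k)=v(w(k))$. For $i\not\equiv j\pmod n$ the affine reflection $(\!(i,j)\!)$ interchanges $i+kn$ and $j+kn$ for all $k\in\mathbb Z$ and fixes other integers. $\lambda_n(k)=k+n$ if $k\not\equiv0\pmod n$ and $\lambda_n(k)=k-n(n-1)$ if $k\equiv0\pmod n$; its reflection length is $2n-2$. A tree-like factorization of $\lambda_n$ is a sequence $[r_1,\dots,r_{2n-2}]$ of affine reflections with $r_1\cdots r_{2n-2}=\lambda_n$ for which there exist integers $a_0,\dots,a_{2n-3},b_1,\dots,b_{2n-2}$ with $r_k=(\!(a_{k-1},b_k)\!)$, $a_{k-1}<b_k$ ($1\le k\le 2n-2$), and $a_k\equiv b_k\pmod n$ ($1\le k\le 2n-3$). The reflection $r_\ell$ increases an integer $k$ if $r_\ell r_{\ell+1}\cdots r_{2n-2}(k)>r_{\ell+1}\cdots r_{2n-2}(k)$. -}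

module Defs where

open import Data.Nat as ℕ using (ℕ; zero; suc)
import Data.Nat.Divisibility as ℕD
open import Data.Integer using (ℤ; +_; _+_; _-_; _*_; ∣_∣)
open import Data.Integer.Divisibility as ℤD using ()
open import Relation.Nullary using (¬_; Dec; does)
open import Data.Bool using (if_then_else_)

_≡[mod_]_ : ℤ → ℕ → ℤ → Set
a ≡[mod n ] b = (+ n) ℤD.∣ (a - b)

_≡[mod_]?_ : (a : ℤ) (n : ℕ) (b : ℤ) → Dec (a ≡[mod n ] b)
a ≡[mod n ]? b = n ℕD.∣? ∣ a - b ∣

-- the affine reflection ((i,j)) in the affine symmetric group S̃_n
-- (meaningful when i ≢ j mod n): swaps i+kn and j+kn for all k
affRefl : ℕ → ℤ → ℤ → ℤ → ℤ
affRefl n i j k =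
  if does (k ≡[mod n ]? i) then k + (j - i)
  else if does (k ≡[mod n ]? j) then k + (i - j)
  else k

lam : ℕ → ℤ → ℤ
lam n k =
  if does (k ≡[mod n ]? (+ 0)) then k - (+ n) * (+ (n ℕ.∸ 1))
  else k + (+ n)

compose : (ℕ → ℤ → ℤ) → ℕ → ℕ → ℤ → ℤ
compose f ℓ zero k = k
compose f ℓ (suc m) k = f ℓ (compose f (suc ℓ) m k)

-- A factorization of length N is a sequence r : ℕ → ℤ × ℤ, where entry ℓ (1 ≤ ℓ ≤ N)
-- is a pair (c , d) with c ≢ d mod n, standing for the reflection ((c,d)).
open import Data.Product using (_×_; _,_; proj₁; proj₂; Σ; ∃; ∃-syntax)
open import Data.Sum using (_⊎_)
open import Relation.Binary.PropositionalEquality using (_≡_)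
open import Data.Integer using (_<_)

reflOf : ℕ → (ℕ → ℤ × ℤ) → ℕ → ℤ → ℤ
reflOf n r ℓ = affRefl n (proj₁ (r ℓ)) (proj₂ (r ℓ))

_≐_ : (ℤ → ℤ) → (ℤ → ℤ) → Set
f ≐ g = ∀ k → f k ≡ g k

IsReflSeq : ℕ → ℕ → (ℕ → ℤ × ℤ) → Set
IsReflSeq n N r = ∀ ℓ → 1 ℕ.≤ ℓ → ℓ ℕ.≤ N → ¬ (proj₁ (r ℓ) ≡[mod n ] proj₂ (r ℓ))

IsFactorizationOfLam : ℕ → (ℕ → ℤ × ℤ) → Set
IsFactorizationOfLam n r =
  IsReflSeq n (2 ℕ.* n ℕ.∸ 2) r ×
  (compose (reflOf n r) 1 (2 ℕ.* n ℕ.∸ 2) ≐ lam n)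

IsTreeLike : ℕ → (ℕ → ℤ × ℤ) → Set
IsTreeLike n r =
  IsFactorizationOfLam n r ×
  Σ (ℕ → ℤ) λ a → Σ (ℕ → ℤ) λ b →
    (∀ k → 1 ℕ.≤ k → k ℕ.≤ N →
       (affRefl n (a (k ℕ.∸ 1)) (b k) ≐ reflOf n r k) × (a (k ℕ.∸ 1) < b k)) ×
    (∀ k → 1 ℕ.≤ k → k ℕ.≤ N ℕ.∸ 1 → a k ≡[mod n ] b k)
  where N = 2 ℕ.* n ℕ.∸ 2

Increases : ℕ → ℕ → (ℕ → ℤ × ℤ) → ℕ → ℤ → Set
Increases n N r ℓ k =
  compose (reflOf n r) (suc ℓ) (N ℕ.∸ ℓ) k < compose (reflOf n r) ℓ (suc N ℕ.∸ ℓ) k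

Touches : ℕ → (ℕ → ℤ × ℤ) → ℕ → ℤ → Set
Touches n r ℓ k =
  ∃[ a ] ∃[ b ] (¬ (a ≡[mod n ] b)) × (affRefl n a b ≐ reflOf n r ℓ) ×
    ((a ≡[mod n ] k) ⊎ (b ≡[mod n ] k))

-- Write r_ℓ = ((A ℓ, B ℓ)) with A ℓ < B ℓ, and take the suffix products σ_ℓ = r_{ℓ+1} ⋯ r_N
-- (N = 2n - 2), so σ_N = id and σ_0 = λ_n. Each r_ℓ permutes the residue classes mod n, and
-- it increases σ_ℓ(x) exactly when σ_ℓ(x) ≡ A ℓ. The tree-like condition B ℓ ≡ A (ℓ+1) keeps
-- σ_ℓ(b_N) in class B ℓ for every ℓ, so each step decreases it and λ_n(b_N) < b_N, which forces
-- b_N ≡ 0. Hence the orbit of a nonzero class never meets B ℓ, and each r_ℓ either increases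
-- it or fixes it. As λ_n(x) = x + n for x ≢ 0, every nonzero class is increased, and in fact
-- twice: with a single increase its class would be the same before and after that step, which
-- however moves class A ℓ to B ℓ ≢ A ℓ. Each r_ℓ increases at most one class, so the n - 1
-- nonzero classes share the 2n - 2 reflections two each. Before the first and after the last
-- increase of k its image is ≡ k, so a reflection there cannot involve the class of k without
-- increasing it.

module Submission where

open import Defs
open import Data.Nat using (ℕ; _≤_; _<_; _*_; _∸_)
open import Data.Integer using (ℤ; +_)
open import Data.Product using (_×_; ∃; ∃-syntax)
open import Data.Sum using (_⊎_)
open import Relation.Binary.PropositionalEquality using (_≡_)
open import Function.Bundles using (_⇔_)

open import Data.Nat as ℕ using (zero; suc; z≤n; s≤s)
import Data.Nat.Properties as ℕ
import Data.Nat.Divisibility as ℕ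
open import Data.Integer as ℤ using (_+_; _-_; -_)
import Data.Integer.Properties as ℤ
import Data.Integer.Divisibility.Signed as ℤ
open import Data.Integer.Tactic.RingSolver using (solve-∀)
open import Data.Product using (_,_; proj₁; proj₂)
open import Data.Sum using (inj₁; inj₂; [_,_])
import Data.Sum as Sum
import Relation.Binary.Reasoning.Setoid
open import Data.Empty using (⊥; ⊥-elim)
open import Function.Base using (_∘_)
open import Function.Bundles using (mk⇔; Equivalence)
open import Algebra.Properties.CommutativeSemigroup ℕ.+-commutativeSemigroup
  using () renaming (interchange to +-interchange)
open import Relation.Nullary using (¬_; Dec; yes; no; contradiction)
open import Relation.Nullary.Decidable using (map′; _×-dec_)
open import Relation.Binary.Definitions using (tri<; tri≈; tri>)
open import Relation.Binary.Structures using (IsEquivalence)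
open import Relation.Binary.Bundles using (Setoid)
open import Relation.Binary.PropositionalEquality
  using (_≢_; refl; sym; trans; cong; subst; subst₂; module ≡-Reasoning)

module Congruence (n : ℕ) where

  infix 4 _≈_ _≉_ _≈?_

  -- A record rather than a synonym of _≡[mod n ]_, so that x and y can be inferred from x ≈ y.
  record _≈_ (x y : ℤ) : Set where
    constructor mk≈
    field ≈⇒≡[mod] : x ≡[mod n ] y
  open _≈_ public

  _≉_ : ℤ → ℤ → Set
  x ≉ y = ¬ x ≈ y

  _≈?_ : ∀ x y → Dec (x ≈ y)
  x ≈? y = map′ mk≈ ≈⇒≡[mod] (x ≡[mod n ]? y)

  private
    ≈⇒∣ : ∀ {x y} → x ≈ y → + n ℤ.∣ x - y
    ≈⇒∣ (mk≈ p) = ℤ.∣ᵤ⇒∣ p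

    ∣⇒≈ : ∀ {x y} → + n ℤ.∣ x - y → x ≈ y
    ∣⇒≈ p = mk≈ (ℤ.∣⇒∣ᵤ p)

    ≈-by-difference : ∀ {x y u v} → x - y ≡ u - v → u ≈ v → x ≈ y
    ≈-by-difference e u≈v = ∣⇒≈ (subst (+ n ℤ.∣_) (sym e) (≈⇒∣ u≈v))

  ≈-reflexive : ∀ {x y} → x ≡ y → x ≈ y
  ≈-reflexive {x} refl = ∣⇒≈ (subst (+ n ℤ.∣_) (sym (ℤ.+-inverseʳ x)) (ℤ.divides (+ 0) refl))

  ≈-refl : ∀ {x} → x ≈ x
  ≈-refl = ≈-reflexive refl

  ≈-sym : ∀ {x y} → x ≈ y → y ≈ x
  ≈-sym {x} {y} x≈y = ∣⇒≈ (subst (+ n ℤ.∣_) (negate-difference x y) (ℤ.∣m⇒∣-m (≈⇒∣ x≈y)))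
    where
    negate-difference : ∀ x y → - (x - y) ≡ y - x
    negate-difference = solve-∀

  ≈-trans : ∀ {x y z} → x ≈ y → y ≈ z → x ≈ z
  ≈-trans {x} {y} {z} x≈y y≈z =
    ∣⇒≈ (subst (+ n ℤ.∣_) (ℤ.+-minus-telescope x y z) (ℤ.∣m∣n⇒∣m+n (≈⇒∣ x≈y) (≈⇒∣ y≈z)))

  ≈-isEquivalence : IsEquivalence _≈_
  ≈-isEquivalence = record { refl = ≈-refl ; sym = ≈-sym ; trans = ≈-trans }

  ≈-setoid : Setoid _ _
  ≈-setoid = record { isEquivalence = ≈-isEquivalence }

  +n≈ : ∀ x → x + + n ≈ x
  +n≈ x = ∣⇒≈ (ℤ.divides (+ 1) (difference x (+ n)))
    where
    difference : ∀ x m → x + m - x ≡ + 1 ℤ.* m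
    difference = solve-∀

  shift-≈ : ∀ {x a} b → x ≈ a → x + (b - a) ≈ b
  shift-≈ {x} {a} b = ≈-by-difference (difference x a b)
    where
    difference : ∀ x a b → x + (b - a) - b ≡ x - a
    difference = solve-∀

  shift-fixes⇒≈ : ∀ x a b → x + (b - a) ≡ x → a ≈ b
  shift-fixes⇒≈ x a b e = ≈-by-difference (difference x a b) (≈-reflexive (sym e))
    where
    difference : ∀ x a b → a - b ≡ x - (x + (b - a))
    difference = solve-∀

  +-≉ : ∀ {i j} → i < j → j < n → + j ≉ + i
  +-≉ {i} {j} i<j j<n (mk≈ n∣j-i) = ℕ.<⇒≱ (ℕ.≤-<-trans (ℕ.m∸n≤m j i) j<n) n≤j∸i
    where
    ∣j-i∣≡j∸i : ℤ.∣ + j - + i ∣ ≡ j ∸ i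
    ∣j-i∣≡j∸i = trans (cong ℤ.∣_∣ (ℤ.[+m]-[+n]≡m⊖n j i)) (cong ℤ.∣_∣ (ℤ.⊖-≥ (ℕ.<⇒≤ i<j)))
    n≤j∸i : n ≤ j ∸ i
    n≤j∸i = ℕ.∣⇒≤ {{ℕ.>-nonZero (ℕ.m<n⇒0<n∸m i<j)}} (subst (n ℕ.∣_) ∣j-i∣≡j∸i n∣j-i)

  +-≈⇒≡ : ∀ {i j} → i < n → j < n → + i ≈ + j → i ≡ j
  +-≈⇒≡ {i} {j} i<n j<n i≈j with ℕ.<-cmp i j
  ... | tri≈ _ i≡j _ = i≡j
  ... | tri< i<j _ _ = contradiction (≈-sym i≈j) (+-≉ i<j j<n)
  ... | tri> _ _ j<i = contradiction i≈j (+-≉ j<i i<n)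

module AffineReflection (n : ℕ) where

  open Congruence n
  open ≡-Reasoning

  private
    shift-up : ∀ x {a b} → a ℤ.< b → x ℤ.< x + (b - a)
    shift-up x {a} {b} a<b = subst (ℤ._< x + (b - a)) (ℤ.+-identityʳ x)
      (ℤ.+-monoʳ-< x (subst (ℤ._< b - a) (ℤ.+-inverseʳ a) (ℤ.+-monoˡ-< (- a) a<b)))

    shift-back : ∀ x a b → x + (b - a) + (a - b) ≡ x
    shift-back = solve-∀

    shift-down : ∀ x {a b} → a ℤ.< b → x + (a - b) ℤ.< x
    shift-down x {a} {b} a<b = subst (x + (a - b) ℤ.<_) (ℤ.+-identityʳ x)
      (ℤ.+-monoʳ-< x (subst (a - b ℤ.<_) (ℤ.+-inverseʳ b) (ℤ.+-monoˡ-< (- b) a<b)))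

  affRefl-≈ˡ : ∀ {a b x} → x ≈ a → affRefl n a b x ≡ x + (b - a)
  affRefl-≈ˡ {a} {b} {x} x≈a with x ≡[mod n ]? a
  ... | yes _ = refl
  ... | no x≢a = contradiction (≈⇒≡[mod] x≈a) x≢a

  affRefl-≈ʳ : ∀ {a b x} → x ≉ a → x ≈ b → affRefl n a b x ≡ x + (a - b)
  affRefl-≈ʳ {a} {b} {x} x≉a x≈b with x ≡[mod n ]? a | x ≡[mod n ]? b
  ... | yes x≡a | _ = contradiction (mk≈ x≡a) x≉a
  ... | no _ | yes _ = refl
  ... | no _ | no x≢b = contradiction (≈⇒≡[mod] x≈b) x≢b

  affRefl-≉ : ∀ {a b x} → x ≉ a → x ≉ b → affRefl n a b x ≡ x
  affRefl-≉ {a} {b} {x} x≉a x≉b with x ≡[mod n ]? a | x ≡[mod n ]? b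
  ... | yes x≡a | _ = contradiction (mk≈ x≡a) x≉a
  ... | no _ | yes x≡b = contradiction (mk≈ x≡b) x≉b
  ... | no _ | no _ = refl

  data AffReflView (a b x : ℤ) : Set where
    at-a  : x ≈ a → affRefl n a b x ≡ x + (b - a) → AffReflView a b x
    at-b  : x ≉ a → x ≈ b → affRefl n a b x ≡ x + (a - b) → AffReflView a b x
    fixed : x ≉ a → x ≉ b → affRefl n a b x ≡ x → AffReflView a b x

  affReflView : ∀ a b x → AffReflView a b x
  affReflView a b x with x ≈? a | x ≈? b
  ... | yes x≈a | _      = at-a x≈a (affRefl-≈ˡ x≈a)
  ... | no x≉a | yes x≈b = at-b x≉a x≈b (affRefl-≈ʳ x≉a x≈b)
  ... | no x≉a | no x≉b  = fixed x≉a x≉b (affRefl-≉ x≉a x≉b)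

  module _ {a b : ℤ} where

    affRefl-a↦b : ∀ {x} → x ≈ a → affRefl n a b x ≈ b
    affRefl-a↦b x≈a = subst (_≈ b) (sym (affRefl-≈ˡ x≈a)) (shift-≈ b x≈a)

    affRefl-b↦a : ∀ {x} → x ≉ a → x ≈ b → affRefl n a b x ≈ a
    affRefl-b↦a x≉a x≈b = subst (_≈ a) (sym (affRefl-≈ʳ x≉a x≈b)) (shift-≈ a x≈b)

    affRefl-increases⇔ : ∀ {x} → a ℤ.< b → (x ℤ.< affRefl n a b x) ⇔ (x ≈ a)
    affRefl-increases⇔ {x} a<b = mk⇔ to from
      where
      to : x ℤ.< affRefl n a b x → x ≈ a
      to x<x′ with affReflView a b x
      ... | at-a x≈a _  = x≈a
      ... | at-b _ _ e  = contradiction (subst (x ℤ.<_) e x<x′) (ℤ.<-asym (shift-down x a<b))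
      ... | fixed _ _ e = contradiction (subst (x ℤ.<_) e x<x′) (ℤ.<-irrefl refl)
      from : x ≈ a → x ℤ.< affRefl n a b x
      from x≈a = subst (x ℤ.<_) (sym (affRefl-≈ˡ x≈a)) (shift-up x a<b)

    affRefl-decreases : ∀ {x} → a ℤ.< b → x ≉ a → x ≈ b → affRefl n a b x ℤ.< x
    affRefl-decreases {x} a<b x≉a x≈b =
      subst (ℤ._< x) (sym (affRefl-≈ʳ x≉a x≈b)) (shift-down x a<b)

    affRefl-moves⇔ : ∀ {x} → a ≉ b → (affRefl n a b x ≢ x) ⇔ (x ≈ a ⊎ x ≈ b)
    affRefl-moves⇔ {x} a≉b = mk⇔ to from
      where
      to : affRefl n a b x ≢ x → x ≈ a ⊎ x ≈ b
      to moved with affReflView a b x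
      ... | at-a x≈a _  = inj₁ x≈a
      ... | at-b _ x≈b _ = inj₂ x≈b
      ... | fixed _ _ e = contradiction e moved
      from : x ≈ a ⊎ x ≈ b → affRefl n a b x ≢ x
      from x∈ab e with affReflView a b x
      ... | at-a _ e′ = a≉b (shift-fixes⇒≈ x a b (trans (sym e′) e))
      ... | at-b _ _ e′ = a≉b (≈-sym (shift-fixes⇒≈ x b a (trans (sym e′) e)))
      ... | fixed x≉a x≉b _ = [ x≉a , x≉b ] x∈ab

    affRefl-degenerate : ∀ {x} → a ≈ b → affRefl n a b x ≈ x
    affRefl-degenerate {x} a≈b with affReflView a b x
    ... | at-a x≈a _    = ≈-trans (affRefl-a↦b x≈a) (≈-trans (≈-sym a≈b) (≈-sym x≈a))
    ... | at-b x≉a x≈b _ = ≈-trans (affRefl-b↦a x≉a x≈b) (≈-trans a≈b (≈-sym x≈b))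
    ... | fixed _ _ e   = ≈-reflexive e

    affRefl-cong : ∀ {x y} → x ≈ y → affRefl n a b x ≈ affRefl n a b y
    affRefl-cong {x} {y} x≈y with affReflView a b x
    ... | at-a x≈a _ = ≈-trans (affRefl-a↦b x≈a) (≈-sym (affRefl-a↦b (≈-trans (≈-sym x≈y) x≈a)))
    ... | at-b x≉a x≈b _ = ≈-trans (affRefl-b↦a x≉a x≈b)
          (≈-sym (affRefl-b↦a (λ y≈a → x≉a (≈-trans x≈y y≈a)) (≈-trans (≈-sym x≈y) x≈b)))
    ... | fixed x≉a x≉b e = ≈-trans (≈-reflexive e) (≈-trans x≈y (≈-sym (≈-reflexive
          (affRefl-≉ (λ y≈a → x≉a (≈-trans x≈y y≈a)) (λ y≈b → x≉b (≈-trans x≈y y≈b))))))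

    affRefl-involutive : ∀ {x} → a ≉ b → affRefl n a b (affRefl n a b x) ≡ x
    affRefl-involutive {x} a≉b with affReflView a b x
    ... | at-a x≈a e = begin
      affRefl n a b (affRefl n a b x)   ≡⟨ cong (affRefl n a b) e ⟩
      affRefl n a b (x + (b - a))       ≡⟨ affRefl-≈ʳ (λ y≈a → a≉b (≈-trans (≈-sym y≈a) y≈b)) y≈b ⟩
      x + (b - a) + (a - b)             ≡⟨ shift-back x a b ⟩
      x                                 ∎
      where
      y≈b : x + (b - a) ≈ b
      y≈b = shift-≈ b x≈a
    ... | at-b x≉a x≈b e = begin
      affRefl n a b (affRefl n a b x)   ≡⟨ cong (affRefl n a b) e ⟩
      affRefl n a b (x + (a - b))       ≡⟨ affRefl-≈ˡ (shift-≈ a x≈b) ⟩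
      x + (a - b) + (b - a)             ≡⟨ shift-back x b a ⟩
      x                                 ∎
    ... | fixed _ _ e = trans (cong (affRefl n a b) e) e

    affRefl-injective : ∀ {x y} → a ≉ b → affRefl n a b x ≈ affRefl n a b y → x ≈ y
    affRefl-injective a≉b e =
      subst₂ _≈_ (affRefl-involutive a≉b) (affRefl-involutive a≉b) (affRefl-cong e)

  affRefl-≐⇒≉ : ∀ {a b c d} → c ≉ d → affRefl n a b ≐ affRefl n c d → a ≉ b
  affRefl-≐⇒≉ {c = c} {d} c≉d same a≈b =
    c≉d (≈-trans (≈-sym (affRefl-degenerate a≈b)) (subst (_≈ d) (sym (same c)) (affRefl-a↦b ≈-refl)))

sumTo : ℕ → (ℕ → ℕ) → ℕ
sumTo zero    f = 0
sumTo (suc K) f = f (suc K) ℕ.+ sumTo K f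

private
  restrict : ∀ {P : ℕ → Set} {K} → (∀ {k} → 1 ≤ k → k ≤ suc K → P k) → ∀ {k} → 1 ≤ k → k ≤ K → P k
  restrict h 1≤k k≤K = h 1≤k (ℕ.m≤n⇒m≤1+n k≤K)

module _ {f g : ℕ → ℕ} where

  sumTo-+ : ∀ K → sumTo K (λ k → f k ℕ.+ g k) ≡ sumTo K f ℕ.+ sumTo K g
  sumTo-+ zero    = refl
  sumTo-+ (suc K) = trans (cong (f (suc K) ℕ.+ g (suc K) ℕ.+_) (sumTo-+ K))
                          (+-interchange (f (suc K)) (g (suc K)) (sumTo K f) (sumTo K g))

  sumTo-mono-≤ : ∀ {K} → (∀ {k} → 1 ≤ k → k ≤ K → f k ≤ g k) → sumTo K f ≤ sumTo K g
  sumTo-mono-≤ {zero}  f≤g = z≤n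
  sumTo-mono-≤ {suc K} f≤g =
    ℕ.+-mono-≤ (f≤g (s≤s z≤n) ℕ.≤-refl) (sumTo-mono-≤ (restrict f≤g))

  sumTo-mono-< : ∀ {K} → (∀ {k} → 1 ≤ k → k ≤ K → f k ≤ g k) →
                 ∀ {k₀} → 1 ≤ k₀ → k₀ ≤ K → f k₀ < g k₀ → sumTo K f < sumTo K g
  sumTo-mono-< {zero}  _ 1≤k₀ k₀≤0 = contradiction (ℕ.≤-trans 1≤k₀ k₀≤0) λ ()
  sumTo-mono-< {suc K} f≤g 1≤k₀ k₀≤1+K fk₀<gk₀ with ℕ.m≤n⇒m<n∨m≡n k₀≤1+K
  ... | inj₂ refl       = ℕ.+-mono-<-≤ fk₀<gk₀ (sumTo-mono-≤ (restrict f≤g))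
  ... | inj₁ (s≤s k₀≤K) =
    ℕ.+-mono-≤-< (f≤g (s≤s z≤n) ℕ.≤-refl) (sumTo-mono-< (restrict f≤g) 1≤k₀ k₀≤K fk₀<gk₀)

sumTo-const : ∀ K c → sumTo K (λ _ → c) ≡ c * K
sumTo-const zero    c = sym (ℕ.*-zeroʳ c)
sumTo-const (suc K) c = trans (cong (c ℕ.+_) (sumTo-const K c)) (sym (ℕ.*-suc c K))

module DoubleCounting {Q : ℕ → ℕ → Set} (Q? : ∀ k ℓ → Dec (Q k ℓ)) where

  indicator : ∀ {P : Set} → Dec P → ℕ
  indicator (yes _) = 1
  indicator (no _)  = 0

  hits : ℕ → ℕ → ℕ
  hits k zero    = 0
  hits k (suc m) = indicator (Q? k (suc m)) ℕ.+ hits k m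

  hits-mono : ∀ {k m m′} → m ≤ m′ → hits k m ≤ hits k m′
  hits-mono {m′ = zero} z≤n = z≤n
  hits-mono {k} {m} {suc m′} m≤1+m′ with ℕ.m≤n⇒m<n∨m≡n m≤1+m′
  ... | inj₂ refl       = ℕ.≤-refl
  ... | inj₁ (s≤s m≤m′) = ℕ.≤-trans (hits-mono m≤m′) (ℕ.m≤n+m (hits k m′) _)

  hit-counted : ∀ {k ℓ m} → 1 ≤ ℓ → ℓ ≤ m → Q k ℓ → suc (hits k (ℕ.pred ℓ)) ≤ hits k m
  hit-counted {k} {suc ℓ} _ 1+ℓ≤m q = ℕ.≤-trans counted (hits-mono 1+ℓ≤m)
    where
    counted : suc (hits k ℓ) ≤ hits k (suc ℓ)
    counted with Q? k (suc ℓ)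
    ... | yes _ = ℕ.≤-refl
    ... | no ¬q = contradiction q ¬q

  two-hits : ∀ {k ℓ₁ ℓ₂ m} → 1 ≤ ℓ₁ → ℓ₁ < ℓ₂ → ℓ₂ ≤ m → Q k ℓ₁ → Q k ℓ₂ → 2 ≤ hits k m
  two-hits 1≤ℓ₁ ℓ₁<ℓ₂ ℓ₂≤m q₁ q₂ =
    ℕ.≤-trans (s≤s (ℕ.≤-trans (s≤s z≤n) (hit-counted 1≤ℓ₁ (ℕ.<⇒≤pred ℓ₁<ℓ₂) q₁)))
              (hit-counted (ℕ.≤-trans 1≤ℓ₁ (ℕ.<⇒≤ ℓ₁<ℓ₂)) ℓ₂≤m q₂)

  three-hits : ∀ {k ℓ₁ ℓ₂ ℓ₃ m} → 1 ≤ ℓ₁ → ℓ₁ < ℓ₂ → ℓ₂ < ℓ₃ → ℓ₃ ≤ m →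
               Q k ℓ₁ → Q k ℓ₂ → Q k ℓ₃ → 3 ≤ hits k m
  three-hits 1≤ℓ₁ ℓ₁<ℓ₂ ℓ₂<ℓ₃ ℓ₃≤m q₁ q₂ q₃ =
    ℕ.≤-trans (s≤s (two-hits 1≤ℓ₁ ℓ₁<ℓ₂ (ℕ.<⇒≤pred ℓ₂<ℓ₃) q₁ q₂))
              (hit-counted (ℕ.≤-trans 1≤ℓ₁ (ℕ.<⇒≤ (ℕ.<-trans ℓ₁<ℓ₂ ℓ₂<ℓ₃))) ℓ₃≤m q₃)

  module _ {M : ℕ}
           (unique : ∀ {ℓ i j} → 1 ≤ i → i ≤ M → 1 ≤ j → j ≤ M → Q i ℓ → Q j ℓ → i ≡ j) where

    private
      none-hit : ∀ {ℓ K} → (∀ {k} → 1 ≤ k → k ≤ K → ¬ Q k ℓ) →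
                 sumTo K (λ k → indicator (Q? k ℓ)) ≡ 0
      none-hit {ℓ} {zero}  _    = refl
      none-hit {ℓ} {suc K} none with Q? (suc K) ℓ
      ... | yes q = contradiction q (none (s≤s z≤n) ℕ.≤-refl)
      ... | no _  = none-hit (restrict none)

      at-most-one-hit : ∀ ℓ K → K ≤ M → sumTo K (λ k → indicator (Q? k ℓ)) ≤ 1
      at-most-one-hit ℓ zero    _     = z≤n
      at-most-one-hit ℓ (suc K) 1+K≤M with Q? (suc K) ℓ
      ... | no _  = at-most-one-hit ℓ K (ℕ.≤-trans (ℕ.n≤1+n K) 1+K≤M)
      ... | yes q = ℕ.≤-reflexive (cong suc (none-hit λ 1≤k k≤K qk →
                      ℕ.<-irrefl (unique 1≤k (ℕ.≤-trans (ℕ.m≤n⇒m≤1+n k≤K) 1+K≤M) (s≤s z≤n) 1+K≤M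
                                         qk q)
                                 (s≤s k≤K)))

    total-hits : ∀ m → sumTo M (λ k → hits k m) ≤ m
    total-hits zero    = ℕ.≤-reflexive (trans (sumTo-const M 0) (ℕ.*-zeroˡ M))
    total-hits (suc m) = begin
      sumTo M (λ k → indicator (Q? k (suc m)) ℕ.+ hits k m)           ≡⟨ sumTo-+ M ⟩
      sumTo M (λ k → indicator (Q? k (suc m))) ℕ.+ sumTo M (λ k → hits k m)
        ≤⟨ ℕ.+-mono-≤ (at-most-one-hit (suc m) M ℕ.≤-refl) (total-hits m) ⟩
      suc m                                                            ∎
      where open ℕ.≤-Reasoning

    at-most-twice : ∀ {N} → N ≤ 2 * M → (∀ {k} → 1 ≤ k → k ≤ M → 2 ≤ hits k N) →
                    ∀ {k} → 1 ≤ k → k ≤ M → hits k N ≤ 2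
    at-most-twice {N} N≤2M twice 1≤k k≤M = ℕ.≮⇒≥ λ 2<hits → ℕ.<-irrefl refl (begin-strict
      2 * M                    ≡⟨ sumTo-const M 2 ⟨
      sumTo M (λ _ → 2)        <⟨ sumTo-mono-< twice 1≤k k≤M 2<hits ⟩
      sumTo M (λ k → hits k N) ≤⟨ total-hits N ⟩
      N                        ≤⟨ N≤2M ⟩
      2 * M                    ∎)
      where open ℕ.≤-Reasoning

downward-induction : ∀ {P : ℕ → Set} {N} → P N → (∀ {m} → suc m ≤ N → P (suc m) → P m) →
                     ∀ {ℓ} → ℓ ≤ N → P ℓ
downward-induction {P} {N} P-N step {ℓ} ℓ≤N = go (N ∸ ℓ) (ℕ.m∸n+n≡m ℓ≤N)
  where
  go : ∀ d {ℓ} → d ℕ.+ ℓ ≡ N → P ℓ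
  go zero    refl = P-N
  go (suc d) {ℓ} d+1+ℓ≡N = step (subst (suc ℓ ≤_) d+1+ℓ≡N (s≤s (ℕ.m≤n+m ℓ d)))
                                (go d (trans (ℕ.+-suc d ℓ) d+1+ℓ≡N))

private
  extend : ∀ {P : ℕ → Set} {m ℓ} → ¬ P (suc m) → (ℓ ≤ m → ¬ P ℓ) → ℓ ≤ suc m → ¬ P ℓ
  extend ¬p none ℓ≤1+m with ℕ.m≤n⇒m<n∨m≡n ℓ≤1+m
  ... | inj₁ (s≤s ℓ≤m) = none ℓ≤m
  ... | inj₂ refl      = ¬p

search-last : ∀ {P : ℕ → Set} → (∀ ℓ → Dec (P ℓ)) → ∀ m →
  (∀ {ℓ} → 1 ≤ ℓ → ℓ ≤ m → ¬ P ℓ) ⊎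
  ∃[ ℓ ] (1 ≤ ℓ × ℓ ≤ m × P ℓ × (∀ {ℓ′} → ℓ < ℓ′ → ℓ′ ≤ m → ¬ P ℓ′))
search-last {P} P? zero = inj₁ λ 1≤ℓ ℓ≤0 → contradiction (ℕ.≤-trans 1≤ℓ ℓ≤0) λ ()
search-last {P} P? (suc m) with P? (suc m)
... | yes p  = inj₂ (suc m , s≤s z≤n , ℕ.≤-refl , p ,
                     λ 1+m<ℓ′ ℓ′≤1+m → contradiction ℓ′≤1+m (ℕ.<⇒≱ 1+m<ℓ′))
... | no ¬p with search-last P? m
...   | inj₁ none = inj₁ λ 1≤ℓ → extend {P} ¬p (none 1≤ℓ)
...   | inj₂ (ℓ , 1≤ℓ , ℓ≤m , p , none-after) =
        inj₂ (ℓ , 1≤ℓ , ℕ.m≤n⇒m≤1+n ℓ≤m , p , λ ℓ<ℓ′ → extend {P} ¬p (none-after ℓ<ℓ′))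

module TreeLikeFactorization (n : ℕ) (n≥2 : 2 ≤ n) (r : ℕ → ℤ × ℤ) (tl : IsTreeLike n r) where

  open Congruence n
  open AffineReflection n

  N : ℕ
  N = 2 * n ∸ 2

  A B : ℕ → ℤ
  A ℓ = proj₁ (proj₂ tl) (ℓ ∸ 1)
  B   = proj₁ (proj₂ (proj₂ tl))

  private
    shape = proj₁ (proj₂ (proj₂ (proj₂ tl)))

  r≐AB : ∀ {ℓ} → 1 ≤ ℓ → ℓ ≤ N → reflOf n r ℓ ≐ affRefl n (A ℓ) (B ℓ)
  r≐AB 1≤ℓ ℓ≤N x = sym (proj₁ (shape _ 1≤ℓ ℓ≤N) x)

  A<B : ∀ {ℓ} → 1 ≤ ℓ → ℓ ≤ N → A ℓ ℤ.< B ℓ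
  A<B 1≤ℓ ℓ≤N = proj₂ (shape _ 1≤ℓ ℓ≤N)

  A≉B : ∀ {ℓ} → 1 ≤ ℓ → ℓ ≤ N → A ℓ ≉ B ℓ
  A≉B 1≤ℓ ℓ≤N = affRefl-≐⇒≉ (proj₁ (proj₁ tl) _ 1≤ℓ ℓ≤N ∘ ≈⇒≡[mod]) (proj₁ (shape _ 1≤ℓ ℓ≤N))

  B≈A-next : ∀ {m} → 1 ≤ m → suc m ≤ N → B m ≈ A (suc m)
  B≈A-next 1≤m 1+m≤N = ≈-sym (mk≈ (proj₂ (proj₂ (proj₂ (proj₂ tl))) _ 1≤m (ℕ.∸-monoˡ-≤ 1 1+m≤N)))

  suffix : ℕ → ℤ → ℤ
  suffix ℓ = compose (reflOf n r) (suc ℓ) (N ∸ ℓ)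

  suffix-0 : suffix 0 ≐ lam n
  suffix-0 = proj₂ (proj₁ tl)

  suffix-N : ∀ x → suffix N x ≡ x
  suffix-N x = cong (λ len → compose (reflOf n r) (suc N) len x) (ℕ.n∸n≡0 N)

  suffix-step : ∀ {m} x → suc m ≤ N →
                suffix m x ≡ affRefl n (A (suc m)) (B (suc m)) (suffix (suc m) x)
  suffix-step {m} x 1+m≤N =
    trans (cong (λ len → compose (reflOf n r) (suc m) len x) (ℕ.+-∸-assoc 1 1+m≤N))
          (r≐AB (s≤s z≤n) 1+m≤N _)

  _increases_ : ℕ → ℤ → Set
  ℓ increases x = Increases n N r ℓ x

  increases⇔ : ∀ {ℓ x} → 1 ≤ ℓ → ℓ ≤ N → ℓ increases x ⇔ suffix ℓ x ≈ A ℓ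
  increases⇔ {suc m} {x} _ 1+m≤N =
    subst (λ y → (suffix (suc m) x ℤ.< y) ⇔ (suffix (suc m) x ≈ A (suc m)))
          (sym (suffix-step x 1+m≤N)) (affRefl-increases⇔ (A<B (s≤s z≤n) 1+m≤N))

  increases? : ∀ ℓ x → Dec (ℓ increases x)
  increases? ℓ x = _ ℤ.<? _

  increase-lands-at-B : ∀ {ℓ x} → 1 ≤ ℓ → ℓ ≤ N → ℓ increases x → suffix (ℕ.pred ℓ) x ≈ B ℓ
  increase-lands-at-B {suc m} {x} 1≤ℓ ℓ≤N inc = subst (_≈ B (suc m)) (sym (suffix-step x ℓ≤N))
    (affRefl-a↦b (Equivalence.to (increases⇔ 1≤ℓ ℓ≤N) inc))

  suffix-injective : ∀ {ℓ x y} → ℓ ≤ N → suffix ℓ x ≈ suffix ℓ y → x ≈ y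
  suffix-injective {x = x} {y} = downward-induction {λ ℓ → suffix ℓ x ≈ suffix ℓ y → x ≈ y}
    (subst₂ _≈_ (suffix-N x) (suffix-N y))
    (λ 1+m≤N ih e → ih (affRefl-injective (A≉B (s≤s z≤n) 1+m≤N)
                          (subst₂ _≈_ (suffix-step x 1+m≤N) (suffix-step y 1+m≤N) e)))

  B⇒≉A : ∀ {ℓ y} → 1 ≤ ℓ → ℓ ≤ N → y ≈ B ℓ → y ≉ A ℓ
  B⇒≉A 1≤ℓ ℓ≤N y≈B y≈A = A≉B 1≤ℓ ℓ≤N (≈-trans (≈-sym y≈A) y≈B)

  B-lands-at-A : ∀ {m x} → suc m ≤ N → suffix (suc m) x ≈ B (suc m) → suffix m x ≈ A (suc m)
  B-lands-at-A {m} {x} 1+m≤N at-B = subst (_≈ A (suc m)) (sym (suffix-step x 1+m≤N))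
    (affRefl-b↦a (B⇒≉A (s≤s z≤n) 1+m≤N at-B) at-B)

  B-decreases : ∀ {m x} → suc m ≤ N → suffix (suc m) x ≈ B (suc m) → suffix m x ℤ.< suffix (suc m) x
  B-decreases {m} {x} 1+m≤N at-B = subst (ℤ._< suffix (suc m) x) (sym (suffix-step x 1+m≤N))
    (affRefl-decreases (A<B (s≤s z≤n) 1+m≤N) (B⇒≉A (s≤s z≤n) 1+m≤N at-B) at-B)

  stays-at-B : ∀ {ℓ x} → ℓ ≤ N → suffix ℓ x ≈ B ℓ → ∀ {ℓ′} → 1 ≤ ℓ′ → ℓ′ ≤ ℓ → suffix ℓ′ x ≈ B ℓ′
  stays-at-B {ℓ} {x} ℓ≤N at-B 1≤ℓ′ ℓ′≤ℓ = downward-induction {λ ℓ′ → 1 ≤ ℓ′ → suffix ℓ′ x ≈ B ℓ′}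
    (λ _ → at-B)
    (λ 1+m≤ℓ ih 1≤m → ≈-trans (B-lands-at-A (ℕ.≤-trans 1+m≤ℓ ℓ≤N) (ih (s≤s z≤n)))
                              (≈-sym (B≈A-next 1≤m (ℕ.≤-trans 1+m≤ℓ ℓ≤N))))
    ℓ′≤ℓ 1≤ℓ′

  descends-from-B : ∀ {ℓ x} → 1 ≤ ℓ → ℓ ≤ N → suffix ℓ x ≈ B ℓ → lam n x ℤ.< suffix ℓ x
  descends-from-B {suc zero} {x} _ 1≤N at-B =
    subst (ℤ._< suffix 1 x) (suffix-0 x) (B-decreases 1≤N at-B)
  descends-from-B {suc (suc m)} {x} _ 2+m≤N at-B =
    ℤ.<-trans (descends-from-B (s≤s z≤n) (ℕ.<⇒≤ 2+m≤N) next-at-B) (B-decreases 2+m≤N at-B)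
    where
    next-at-B : suffix (suc m) x ≈ B (suc m)
    next-at-B = ≈-trans (B-lands-at-A 2+m≤N at-B) (≈-sym (B≈A-next (s≤s z≤n) 2+m≤N))

  lam-≉0 : ∀ {x} → x ≉ + 0 → lam n x ≡ x + + n
  lam-≉0 {x} x≉0 with x ≡[mod n ]? (+ 0)
  ... | yes x≡0 = contradiction (mk≈ x≡0) x≉0
  ... | no _    = refl

  lam≈ : ∀ {x} → x ≉ + 0 → lam n x ≈ x
  lam≈ {x} x≉0 = subst (_≈ x) (sym (lam-≉0 x≉0)) (+n≈ x)

  <lam : ∀ {x} → x ≉ + 0 → x ℤ.< lam n x
  <lam {x} x≉0 = subst (x ℤ.<_) (sym (lam-≉0 x≉0))
    (subst (ℤ._< x + + n) (ℤ.+-identityʳ x) (ℤ.+-monoʳ-< x (ℤ.+<+ (ℕ.≤-trans (s≤s z≤n) n≥2))))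

  1≤N : 1 ≤ N
  1≤N = ℕ.≤-trans (s≤s z≤n) (ℕ.∸-monoˡ-≤ 2 (ℕ.*-monoʳ-≤ 2 n≥2))

  B-N≈0 : B N ≈ + 0
  B-N≈0 with B N ≈? + 0
  ... | yes B-N≈0 = B-N≈0
  ... | no B-N≉0  = contradiction (descends-from-B 1≤N ℕ.≤-refl (≈-reflexive (suffix-N (B N))))
    (ℤ.<-asym (subst (ℤ._< lam n (B N)) (sym (suffix-N (B N))) (<lam B-N≉0)))

  never-at-B : ∀ {ℓ x} → x ≉ + 0 → 1 ≤ ℓ → ℓ ≤ N → suffix ℓ x ≉ B ℓ
  never-at-B {ℓ} {x} x≉0 1≤ℓ ℓ≤N at-B = x≉0 (≈-trans (suffix-injective ℓ≤N suffixes-≈) B-N≈0)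
    where
    suffixes-≈ : suffix ℓ x ≈ suffix ℓ (B N)
    suffixes-≈ = ≈-trans at-B (≈-sym (stays-at-B ℕ.≤-refl (≈-reflexive (suffix-N (B N))) 1≤ℓ ℓ≤N))

  touches⇔ : ∀ {ℓ x} → 1 ≤ ℓ → ℓ ≤ N → Touches n r ℓ x ⇔ (x ≈ A ℓ ⊎ x ≈ B ℓ)
  touches⇔ {ℓ} {x} 1≤ℓ ℓ≤N = mk⇔ to from
    where
    to : Touches n r ℓ x → x ≈ A ℓ ⊎ x ≈ B ℓ
    to (a , b , a≢b , same , x∈ab) = Equivalence.to (affRefl-moves⇔ (A≉B 1≤ℓ ℓ≤N)) λ fixed →
      Equivalence.from (affRefl-moves⇔ (a≢b ∘ ≈⇒≡[mod])) (Sum.map (≈-sym ∘ mk≈) (≈-sym ∘ mk≈) x∈ab)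
        (trans (same x) (trans (r≐AB 1≤ℓ ℓ≤N x) fixed))
    from : x ≈ A ℓ ⊎ x ≈ B ℓ → Touches n r ℓ x
    from x∈AB = A ℓ , B ℓ , A≉B 1≤ℓ ℓ≤N ∘ mk≈ , (λ y → sym (r≐AB 1≤ℓ ℓ≤N y)) ,
                Sum.map (≈⇒≡[mod] ∘ ≈-sym) (≈⇒≡[mod] ∘ ≈-sym) x∈AB

  IsIncrease : ℤ → ℕ → Set
  IsIncrease x ℓ = 1 ≤ ℓ × ℓ ≤ N × ℓ increases x

  module NonzeroClass {x : ℤ} (x≉0 : x ≉ + 0) where

    fixed-unless-increases : ∀ {m} → suc m ≤ N → ¬ suc m increases x → suffix m x ≡ suffix (suc m) x
    fixed-unless-increases 1+m≤N ¬inc = trans (suffix-step x 1+m≤N) (affRefl-≉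
      (¬inc ∘ Equivalence.from (increases⇔ (s≤s z≤n) 1+m≤N)) (never-at-B x≉0 (s≤s z≤n) 1+m≤N))

    suffix-constant : ∀ {lo hi} → lo ≤ hi → hi ≤ N → (∀ {ℓ} → lo < ℓ → ℓ ≤ hi → ¬ ℓ increases x) →
                      suffix lo x ≡ suffix hi x
    suffix-constant {hi = zero}  z≤n _ _ = refl
    suffix-constant {lo} {suc h} lo≤1+h 1+h≤N quiet with ℕ.m≤n⇒m<n∨m≡n lo≤1+h
    ... | inj₂ refl       = refl
    ... | inj₁ (s≤s lo≤h) =
      trans (suffix-constant lo≤h (ℕ.<⇒≤ 1+h≤N) (λ lo<ℓ ℓ≤h → quiet lo<ℓ (ℕ.m≤n⇒m≤1+n ℓ≤h)))
            (fixed-unless-increases 1+h≤N (quiet (s≤s lo≤h) ℕ.≤-refl))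

    touch-at-rest-increases : ∀ {ℓ} → 1 ≤ ℓ → ℓ ≤ N → suffix ℓ x ≈ x →
                              Touches n r ℓ x → ℓ increases x
    touch-at-rest-increases 1≤ℓ ℓ≤N at-rest touch =
      [ (λ x≈A → Equivalence.from (increases⇔ 1≤ℓ ℓ≤N) (≈-trans at-rest x≈A))
      , (λ x≈B → contradiction (≈-trans at-rest x≈B) (never-at-B x≉0 1≤ℓ ℓ≤N))
      ] (Equivalence.to (touches⇔ 1≤ℓ ℓ≤N) touch)

    record TwoIncreases : Set where
      field
        ℓ₁ ℓ₂ : ℕ
        ℓ₁<ℓ₂ : ℓ₁ < ℓ₂
        first : IsIncrease x ℓ₁
        last  : IsIncrease x ℓ₂

    increased-twice : TwoIncreases
    increased-twice with search-last (λ ℓ → increases? ℓ x) N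
    ... | inj₁ never = ⊥-elim (ℤ.<-irrefl (sym lam≡x) (<lam x≉0))
      where
      lam≡x : lam n x ≡ x
      lam≡x = trans (sym (suffix-0 x)) (trans (suffix-constant z≤n ℕ.≤-refl never) (suffix-N x))
    ... | inj₂ (suc m , 1≤ℓ₂ , ℓ₂≤N , inc₂ , never-after) with search-last (λ ℓ → increases? ℓ x) m
    ...   | inj₂ (ℓ₁ , 1≤ℓ₁ , ℓ₁≤m , inc₁ , _) = record
            { ℓ₁ = ℓ₁ ; ℓ₂ = suc m ; ℓ₁<ℓ₂ = s≤s ℓ₁≤m
            ; first = 1≤ℓ₁ , ℕ.≤-trans ℓ₁≤m (ℕ.<⇒≤ ℓ₂≤N) , inc₁
            ; last  = 1≤ℓ₂ , ℓ₂≤N , inc₂ }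
    ...   | inj₁ never-before = contradiction A≈B (A≉B 1≤ℓ₂ ℓ₂≤N)
      where
      open Relation.Binary.Reasoning.Setoid ≈-setoid
      A≈B : A (suc m) ≈ B (suc m)
      A≈B = begin
        A (suc m)         ≈⟨ Equivalence.to (increases⇔ 1≤ℓ₂ ℓ₂≤N) inc₂ ⟨
        suffix (suc m) x  ≡⟨ suffix-constant ℓ₂≤N ℕ.≤-refl never-after ⟩
        suffix N x        ≡⟨ suffix-N x ⟩
        x                 ≈⟨ lam≈ x≉0 ⟨
        lam n x           ≡⟨ suffix-0 x ⟨
        suffix 0 x        ≡⟨ suffix-constant z≤n (ℕ.<⇒≤ ℓ₂≤N) never-before ⟩
        suffix m x        ≈⟨ increase-lands-at-B 1≤ℓ₂ ℓ₂≤N inc₂ ⟩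
        B (suc m)         ∎

  open DoubleCounting {λ k → IsIncrease (+ k)}
                      (λ k ℓ → 1 ℕ.≤? ℓ ×-dec ℓ ℕ.≤? N ×-dec increases? ℓ (+ k))

  M : ℕ
  M = n ∸ 1

  ≤M⇒<n : ∀ {k} → k ≤ M → k < n
  ≤M⇒<n {k} k≤M = subst (_≤ n) (ℕ.+-comm k 1) (ℕ.m≤o∸n⇒m+n≤o k (ℕ.≤-trans (s≤s z≤n) n≥2) k≤M)

  at-least-two-increases : ∀ {k} → 1 ≤ k → k ≤ M → 2 ≤ hits k N
  at-least-two-increases 1≤k k≤M = two-hits (proj₁ first) ℓ₁<ℓ₂ (proj₁ (proj₂ last)) first last
    where open NonzeroClass.TwoIncreases (NonzeroClass.increased-twice (+-≉ 1≤k (≤M⇒<n k≤M)))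

  increase-determines-class : ∀ {ℓ x y} → IsIncrease x ℓ → IsIncrease y ℓ → x ≈ y
  increase-determines-class (1≤ℓ , ℓ≤N , incₓ) (_ , _ , incʸ) = suffix-injective ℓ≤N (≈-trans
    (Equivalence.to (increases⇔ 1≤ℓ ℓ≤N) incₓ) (≈-sym (Equivalence.to (increases⇔ 1≤ℓ ℓ≤N) incʸ)))

  at-most-two-increases : ∀ {k} → 1 ≤ k → k ≤ M → hits k N ≤ 2
  at-most-two-increases =
    at-most-twice unique (ℕ.≤-reflexive (sym (ℕ.*-distribˡ-∸ 2 n 1))) at-least-two-increases
    where
    unique : ∀ {ℓ i j} → 1 ≤ i → i ≤ M → 1 ≤ j → j ≤ M →
             IsIncrease (+ i) ℓ → IsIncrease (+ j) ℓ → i ≡ j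
    unique _ i≤M _ j≤M incᵢ incⱼ =
      +-≈⇒≡ (≤M⇒<n i≤M) (≤M⇒<n j≤M) (increase-determines-class incᵢ incⱼ)

  module NonzeroResidue (k : ℕ) (1≤k : 1 ≤ k) (k<n : k < n) where

    k≉0 : + k ≉ + 0
    k≉0 = +-≉ 1≤k k<n

    open NonzeroClass k≉0
    open TwoIncreases increased-twice public

    1≤ℓ₁ : 1 ≤ ℓ₁
    1≤ℓ₁ = proj₁ first

    ℓ₁≤N : ℓ₁ ≤ N
    ℓ₁≤N = proj₁ (proj₂ first)

    1≤ℓ₂ : 1 ≤ ℓ₂
    1≤ℓ₂ = proj₁ last

    ℓ₂≤N : ℓ₂ ≤ N
    ℓ₂≤N = proj₁ (proj₂ last)

    no-third-increase : ∀ {ℓ ℓ′ ℓ″} → ℓ < ℓ′ → ℓ′ < ℓ″ →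
                        IsIncrease (+ k) ℓ → IsIncrease (+ k) ℓ′ → IsIncrease (+ k) ℓ″ → ⊥
    no-third-increase ℓ<ℓ′ ℓ′<ℓ″ inc@(1≤ℓ , _) inc′ inc″@(_ , ℓ″≤N , _) =
      ℕ.<⇒≱ (three-hits 1≤ℓ ℓ<ℓ′ ℓ′<ℓ″ ℓ″≤N inc inc′ inc″)
            (at-most-two-increases 1≤k (ℕ.∸-monoˡ-≤ 1 k<n))

    increase⇔ : ∀ ℓ → IsIncrease (+ k) ℓ ⇔ (ℓ ≡ ℓ₁ ⊎ ℓ ≡ ℓ₂)
    increase⇔ ℓ = mk⇔ to from
      where
      to : IsIncrease (+ k) ℓ → ℓ ≡ ℓ₁ ⊎ ℓ ≡ ℓ₂
      to inc with ℕ.<-cmp ℓ ℓ₁ | ℕ.<-cmp ℓ ℓ₂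
      ... | tri≈ _ ℓ≡ℓ₁ _ | _              = inj₁ ℓ≡ℓ₁
      ... | _             | tri≈ _ ℓ≡ℓ₂ _  = inj₂ ℓ≡ℓ₂
      ... | tri< ℓ<ℓ₁ _ _ | _              = ⊥-elim (no-third-increase ℓ<ℓ₁ ℓ₁<ℓ₂ inc first last)
      ... | tri> _ _ ℓ₁<ℓ | tri< ℓ<ℓ₂ _ _ = ⊥-elim (no-third-increase ℓ₁<ℓ ℓ<ℓ₂ first inc last)
      ... | tri> _ _ _    | tri> _ _ ℓ₂<ℓ  = ⊥-elim (no-third-increase ℓ₁<ℓ₂ ℓ₂<ℓ first last inc)
      from : ℓ ≡ ℓ₁ ⊎ ℓ ≡ ℓ₂ → IsIncrease (+ k) ℓ
      from (inj₁ refl) = first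
      from (inj₂ refl) = last

    increase-between : ∀ {ℓ} → IsIncrease (+ k) ℓ → ℓ₁ ≤ ℓ × ℓ ≤ ℓ₂
    increase-between inc with Equivalence.to (increase⇔ _) inc
    ... | inj₁ refl = ℕ.≤-refl , ℕ.<⇒≤ ℓ₁<ℓ₂
    ... | inj₂ refl = ℕ.<⇒≤ ℓ₁<ℓ₂ , ℕ.≤-refl

    at-rest-before : ∀ {ℓ} → ℓ < ℓ₁ → suffix ℓ (+ k) ≈ + k
    at-rest-before {ℓ} ℓ<ℓ₁ = begin
      suffix ℓ (+ k)  ≡⟨ suffix-constant z≤n ℓ≤N quiet ⟨
      suffix 0 (+ k)  ≡⟨ suffix-0 (+ k) ⟩
      lam n (+ k)     ≈⟨ lam≈ k≉0 ⟩
      + k             ∎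
      where
      open Relation.Binary.Reasoning.Setoid ≈-setoid
      ℓ≤N : ℓ ≤ N
      ℓ≤N = ℕ.≤-trans (ℕ.<⇒≤ ℓ<ℓ₁) ℓ₁≤N
      quiet : ∀ {ℓ′} → 0 < ℓ′ → ℓ′ ≤ ℓ → ¬ ℓ′ increases (+ k)
      quiet 1≤ℓ′ ℓ′≤ℓ inc = ℕ.<⇒≱ (ℕ.≤-<-trans ℓ′≤ℓ ℓ<ℓ₁)
        (proj₁ (increase-between (1≤ℓ′ , ℕ.≤-trans ℓ′≤ℓ ℓ≤N , inc)))

    at-rest-after : ∀ {ℓ} → ℓ₂ ≤ ℓ → ℓ ≤ N → suffix ℓ (+ k) ≡ + k
    at-rest-after {ℓ} ℓ₂≤ℓ ℓ≤N = trans (suffix-constant ℓ≤N ℕ.≤-refl quiet) (suffix-N (+ k))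
      where
      quiet : ∀ {ℓ′} → ℓ < ℓ′ → ℓ′ ≤ N → ¬ ℓ′ increases (+ k)
      quiet ℓ<ℓ′ ℓ′≤N inc = ℕ.<⇒≱ (ℕ.≤-<-trans ℓ₂≤ℓ ℓ<ℓ′)
        (proj₂ (increase-between (ℕ.≤-trans (s≤s z≤n) ℓ<ℓ′ , ℓ′≤N , inc)))

    touches-first : Touches n r ℓ₁ (+ k)
    touches-first = Equivalence.from (touches⇔ 1≤ℓ₁ ℓ₁≤N) (inj₂ (≈-trans
      (≈-sym (at-rest-before (ℕ.≤-reflexive (ℕ.suc-pred ℓ₁ {{ℕ.>-nonZero 1≤ℓ₁}}))))
      (increase-lands-at-B 1≤ℓ₁ ℓ₁≤N (proj₂ (proj₂ first)))))

    touches-last : Touches n r ℓ₂ (+ k)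
    touches-last = Equivalence.from (touches⇔ 1≤ℓ₂ ℓ₂≤N) (inj₁ (subst (_≈ A ℓ₂)
      (at-rest-after ℕ.≤-refl ℓ₂≤N) (Equivalence.to (increases⇔ 1≤ℓ₂ ℓ₂≤N) (proj₂ (proj₂ last)))))

    touches-between : ∀ ℓ → 1 ≤ ℓ → ℓ ≤ N → Touches n r ℓ (+ k) → ℓ₁ ≤ ℓ × ℓ ≤ ℓ₂
    touches-between ℓ 1≤ℓ ℓ≤N touch = ℕ.≮⇒≥ not-before , ℕ.≮⇒≥ not-after
      where
      increase-if-at-rest : suffix ℓ (+ k) ≈ + k → IsIncrease (+ k) ℓ
      increase-if-at-rest at-rest = 1≤ℓ , ℓ≤N , touch-at-rest-increases 1≤ℓ ℓ≤N at-rest touch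
      not-before : ¬ ℓ < ℓ₁
      not-before ℓ<ℓ₁ =
        ℕ.<⇒≱ ℓ<ℓ₁ (proj₁ (increase-between (increase-if-at-rest (at-rest-before ℓ<ℓ₁))))
      not-after : ¬ ℓ₂ < ℓ
      not-after ℓ₂<ℓ = ℕ.<⇒≱ ℓ₂<ℓ (proj₂ (increase-between
        (increase-if-at-rest (≈-reflexive (at-rest-after (ℕ.<⇒≤ ℓ₂<ℓ) ℓ≤N)))))

corollary3p6 : (n : ℕ) → 2 ≤ n → (r : ℕ → ℤ × ℤ) → IsTreeLike n r →
    (k : ℕ) → 1 ≤ k → k < n →
    ∃[ ℓ₁ ] ∃[ ℓ₂ ]
      (ℓ₁ < ℓ₂) ×
      (∀ ℓ → (1 ≤ ℓ × ℓ ≤ 2 * n ∸ 2 × Increases n (2 * n ∸ 2) r ℓ (+ k)) ⇔ (ℓ ≡ ℓ₁ ⊎ ℓ ≡ ℓ₂)) ×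
      (1 ≤ ℓ₁ × Touches n r ℓ₁ (+ k)) ×
      (ℓ₂ ≤ 2 * n ∸ 2 × Touches n r ℓ₂ (+ k)) ×
      (∀ ℓ → 1 ≤ ℓ → ℓ ≤ 2 * n ∸ 2 → Touches n r ℓ (+ k) → ℓ₁ ≤ ℓ × ℓ ≤ ℓ₂)
corollary3p6 n n≥2 r tl k 1≤k k<n =
  ℓ₁ , ℓ₂ , ℓ₁<ℓ₂ , increase⇔ , (1≤ℓ₁ , touches-first) , (ℓ₂≤N , touches-last) , touches-between
  where
  open TreeLikeFactorization n n≥2 r tl
  open NonzeroResidue k 1≤k k<n
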